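{- An element $x$ of an algebraic dcpo $D$ is sharp if and only if for every compact Scott open subset $K$ of $D$ (compact open of the frame of Scott opens), the proposition $x \in K$ is decidable.
   Context: Setting: univalent type theory with universes, function and propositional extensionality, propositional truncations. Fix base universe $\mathcal{U}$; small means equivalent to a type in $\mathcal{U}$. A dcpo $D$ has carrier in $\mathcal{U}^+$, an $\Omega_{\mathcal{U}}$-valued partial order $\sqsubseteq$ and joins of directed families indexed by types in $\mathcal{U}$. An element $c$ is finite if for every small directed family with $c\sqsubseteq\bigsqcup x_i$ there exists $i$ with $c\sqsubseteq x_i$. $D$ is algebraic if for every $x$ the family of finite elements below $x$ is directed with join $x$, and the type of finite elements is small. A subset $S:D\to\Omega_{\mathcal{U}}$ is Scott open if upward closed and such that $\bigsqcup x_i \in S$ for a small directed family implies there exists $i$ with $x_i\in S$; Scott opens ordered by inclusion form a frame. A Scott open $K$ is compact if for every small directed family $(U_i)$ of Scott opens with $K\subseteq\bigcup U_i$ there exists $i$ with $K\subseteq U_i$. An element $x$ is sharp if $c\sqsubseteq x$ is decidable for every finite element $c$. A proposition $P$ is decidable if $P \vee \neg P$. -}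

{-# OPTIONS --without-K #-}
module Defs where

open import Level using (Level; _⊔_; Setω) renaming (suc to lsuc)
open import Data.Product using (Σ; Σ-syntax; _×_; _,_)
open import Data.Sum using (_⊎_)
open import Relation.Nullary using (¬_)
open import Relation.Binary.PropositionalEquality using (_≡_)
open import Function.Bundles using (_↔_)

isProp : ∀ {ℓ} → Set ℓ → Set ℓ
isProp A = (x y : A) → x ≡ y

FunExt : Setω
FunExt = ∀ {ℓ ℓ'} {A : Set ℓ} {B : A → Set ℓ'} {f g : (a : A) → B a}
       → ((a : A) → f a ≡ g a) → f ≡ g

PropExt : Setω
PropExt = ∀ {ℓ} {P Q : Set ℓ} → isProp P → isProp Q → (P → Q) → (Q → P) → P ≡ Q

record PropTrunc : Setω where
  field
    ∥_∥      : ∀ {ℓ} → Set ℓ → Set ℓ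
    ∥∥-isProp : ∀ {ℓ} {A : Set ℓ} → isProp ∥ A ∥
    ∣_∣      : ∀ {ℓ} {A : Set ℓ} → A → ∥ A ∥
    ∥∥-rec   : ∀ {ℓ ℓ'} {A : Set ℓ} {P : Set ℓ'} → isProp P → (A → P) → ∥ A ∥ → P

module WithPT (pt : PropTrunc) where
  open PropTrunc pt

  IsDecidable : ∀ {ℓ} → Set ℓ → Set ℓ
  IsDecidable P = ∥ P ⊎ ¬ P ∥

  isDirectedFor : ∀ {a r ℓ} {A : Set a} (R : A → A → Set r) {I : Set ℓ} → (I → A) → Set (ℓ ⊔ r)
  isDirectedFor R {I} α = ∥ I ∥ × ((i j : I) → ∥ Σ[ k ∈ I ] (R (α i) (α k) × R (α j) (α k)) ∥)

  -- A dcpo over base universe 𝓤: carrier in 𝓤⁺, Ω_𝓤-valued partial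
  -- order, joins of directed families indexed by types in 𝓤.
  record DCPO (𝓤 : Level) : Set (lsuc (lsuc 𝓤)) where
    field
      Carrier   : Set (lsuc 𝓤)
      _⊑_       : Carrier → Carrier → Set 𝓤
      ⊑-isProp  : (x y : Carrier) → isProp (x ⊑ y)
      ⊑-refl    : (x : Carrier) → x ⊑ x
      ⊑-trans   : {x y z : Carrier} → x ⊑ y → y ⊑ z → x ⊑ z
      ⊑-antisym : {x y : Carrier} → x ⊑ y → y ⊑ x → x ≡ y
      ∐         : {I : Set 𝓤} (α : I → Carrier) → isDirectedFor _⊑_ α → Carrier
      ∐-upper   : {I : Set 𝓤} (α : I → Carrier) (δ : isDirectedFor _⊑_ α)
                → (i : I) → α i ⊑ ∐ α δ
      ∐-least   : {I : Set 𝓤} (α : I → Carrier) (δ : isDirectedFor _⊑_ α)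
                → (y : Carrier) → ((i : I) → α i ⊑ y) → ∐ α δ ⊑ y

  module _ {𝓤 : Level} (D : DCPO 𝓤) where
    open DCPO D

    isDirected : ∀ {ℓ} {I : Set ℓ} → (I → Carrier) → Set (ℓ ⊔ 𝓤)
    isDirected = isDirectedFor _⊑_

    isSup : ∀ {ℓ} {I : Set ℓ} → Carrier → (I → Carrier) → Set (lsuc 𝓤 ⊔ ℓ)
    isSup x α = ((i : _) → α i ⊑ x) × ((y : Carrier) → ((i : _) → α i ⊑ y) → x ⊑ y)

    isFinite : Carrier → Set (lsuc 𝓤)
    isFinite c = (I : Set 𝓤) (α : I → Carrier) (δ : isDirected α)
               → c ⊑ ∐ α δ → ∥ Σ[ i ∈ I ] (c ⊑ α i) ∥

    isSmall : ∀ {ℓ} → Set ℓ → Set (lsuc 𝓤 ⊔ ℓ)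
    isSmall A = Σ[ B ∈ Set 𝓤 ] (B ↔ A)

    finitesBelow : Carrier → Set (lsuc 𝓤)
    finitesBelow x = Σ[ c ∈ Carrier ] (isFinite c × (c ⊑ x))

    finitesBelow-fam : (x : Carrier) → finitesBelow x → Carrier
    finitesBelow-fam x (c , _) = c

    isAlgebraic : Set (lsuc 𝓤)
    isAlgebraic = ((x : Carrier) → isDirected (finitesBelow-fam x)
                                 × isSup x (finitesBelow-fam x))
                × isSmall (Σ[ c ∈ Carrier ] isFinite c)

    isSharp : Carrier → Set (lsuc 𝓤)
    isSharp x = (c : Carrier) → isFinite c → IsDecidable (c ⊑ x)

    record ScottOpen : Set (lsuc 𝓤) where
      field
        _∈S          : Carrier → Set 𝓤
        ∈S-isProp    : (x : Carrier) → isProp (x ∈S)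
        upwardClosed : {x y : Carrier} → x ∈S → x ⊑ y → y ∈S
        inaccessible : {I : Set 𝓤} (α : I → Carrier) (δ : isDirected α)
                     → ∐ α δ ∈S → ∥ Σ[ i ∈ I ] (α i ∈S) ∥

    _∈_ : Carrier → ScottOpen → Set 𝓤
    x ∈ U = ScottOpen._∈S U x

    _⊆_ : ScottOpen → ScottOpen → Set (lsuc 𝓤)
    U ⊆ V = (x : Carrier) → x ∈ U → x ∈ V

    _∈⋃_ : {I : Set 𝓤} → Carrier → (I → ScottOpen) → Set 𝓤
    _∈⋃_ {I} x U = ∥ Σ[ i ∈ I ] (x ∈ U i) ∥

    isCompactOpen : ScottOpen → Set (lsuc 𝓤)
    isCompactOpen K = (I : Set 𝓤) (U : I → ScottOpen) → isDirectedFor _⊆_ U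
                    → ((x : Carrier) → x ∈ K → x ∈⋃ U)
                    → ∥ Σ[ i ∈ I ] (K ⊆ U i) ∥

{-# OPTIONS --safe #-}
module Submission where

-- For finite c the upper set ↑c is a compact Scott open, and x ∈ ↑c is c ⊑ x. Conversely,
-- in an algebraic dcpo every Scott open K is the directed union of the opens ↑b₁ ∪ … ∪ ↑bₙ
-- with the bᵢ basis elements in K, so a compact K equals one of them, and x ∈ K becomes
-- the finite disjunction of the decidable propositions bᵢ ⊑ x.

open import Defs
open import Level using (Level)
open import Function.Base using (_∘_)
open import Function.Bundles using (_⇔_; mk⇔; Equivalence; Inverse)
open import Data.Product using (Σ; Σ-syntax; _×_; _,_; proj₁; proj₂)
open import Data.Sum using (_⊎_; inj₁; inj₂)
open import Data.List using (List; []; _∷_; _++_; [_])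
open import Data.List.Relation.Unary.Any as Any using (Any; here; there; satisfied; toSum; fromSum)
open import Data.List.Relation.Unary.Any.Properties using (++⁺ˡ; ++⁺ʳ)
open import Relation.Nullary using (¬_)
open import Relation.Binary.PropositionalEquality using (_≡_; sym; cong; subst)

module _ (pt : PropTrunc) where
  open PropTrunc pt
  open WithPT pt hiding (_∈_; _⊆_; _∈⋃_)

  private variable
    ℓ ℓ' : Level
    A B : Set ℓ

  ∥∥-map : (A → B) → ∥ A ∥ → ∥ B ∥
  ∥∥-map f = ∥∥-rec ∥∥-isProp (λ a → ∣ f a ∣)

  ⇔-isDecidable : A ⇔ B → IsDecidable A → IsDecidable B
  ⇔-isDecidable A⇔B = ∥∥-map λ where
      (inj₁ a)  → inj₁ (to a)
      (inj₂ ¬a) → inj₂ (¬a ∘ from)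
    where open Equivalence A⇔B

  ∥∥-isDecidable : IsDecidable A → IsDecidable ∥ A ∥
  ∥∥-isDecidable = ∥∥-map λ where
    (inj₁ a)  → inj₁ ∣ a ∣
    (inj₂ ¬a) → inj₂ (∥∥-rec (λ ()) ¬a)

  ⊎-isDecidable : IsDecidable A → IsDecidable B → IsDecidable (A ⊎ B)
  ⊎-isDecidable A? B? = ∥∥-rec ∥∥-isProp (λ a? → ∥∥-map (decide a?) B?) A?
    where
    decide : A ⊎ ¬ A → B ⊎ ¬ B → (A ⊎ B) ⊎ ¬ (A ⊎ B)
    decide (inj₁ a)  _         = inj₁ (inj₁ a)
    decide (inj₂ _)  (inj₁ b)  = inj₁ (inj₂ b)
    decide (inj₂ ¬a) (inj₂ ¬b) = inj₂ λ { (inj₁ a) → ¬a a ; (inj₂ b) → ¬b b }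

  Any-isDecidable : {P : A → Set ℓ} → ((a : A) → IsDecidable (P a))
                  → (as : List A) → IsDecidable (Any P as)
  Any-isDecidable P? []       = ∣ inj₂ (λ ()) ∣
  Any-isDecidable P? (a ∷ as) =
    ⇔-isDecidable (mk⇔ fromSum toSum) (⊎-isDecidable (P? a) (Any-isDecidable P? as))

  module _ {𝓤 : Level} (D : DCPO 𝓤) where
    open DCPO D
    open ScottOpen using (∈S-isProp; upwardClosed; inaccessible)

    private
      _∈_ : Carrier → ScottOpen D → Set 𝓤
      _∈_ = WithPT._∈_ pt D

      _⊆_ : ScottOpen D → ScottOpen D → Set (Level.suc 𝓤)
      _⊆_ = WithPT._⊆_ pt D

      _∈⋃_ : {I : Set 𝓤} → Carrier → (I → ScottOpen D) → Set 𝓤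
      _∈⋃_ = WithPT._∈⋃_ pt D

    module _ {I : Set ℓ} {J : Set ℓ'} {α : I → Carrier} {β : J → Carrier}
             (α≲β : (i : I) → Σ[ j ∈ J ] (α i ⊑ β j))
             (β≲α : (j : J) → Σ[ i ∈ I ] (β j ⊑ α i)) where

      isDirected-cofinal : isDirected D α → isDirected D β
      isDirected-cofinal (inhabited , semidirected) =
          ∥∥-map (proj₁ ∘ α≲β) inhabited
        , λ j j' → ∥∥-map (bound j j') (semidirected (proj₁ (β≲α j)) (proj₁ (β≲α j')))
        where
        bound : (j j' : J) → Σ[ k ∈ I ] (α (proj₁ (β≲α j)) ⊑ α k × α (proj₁ (β≲α j')) ⊑ α k)
              → Σ[ l ∈ J ] (β j ⊑ β l × β j' ⊑ β l)
        bound j j' (k , ⊑k , ⊑k') =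
          let (l , k⊑l) = α≲β k
          in l , ⊑-trans (proj₂ (β≲α j)) (⊑-trans ⊑k k⊑l)
               , ⊑-trans (proj₂ (β≲α j')) (⊑-trans ⊑k' k⊑l)

      isSup-cofinal : {y : Carrier} → isSup D y α → isSup D y β
      isSup-cofinal (upper , least) =
          (λ j → ⊑-trans (proj₂ (β≲α j)) (upper (proj₁ (β≲α j))))
        , λ z β≤z → least z (λ i → ⊑-trans (proj₂ (α≲β i)) (β≤z (proj₁ (α≲β i))))

    ∐-unique : {I : Set 𝓤} {α : I → Carrier} (δ : isDirected D α) {y : Carrier}
             → isSup D y α → ∐ α δ ≡ y
    ∐-unique {α = α} δ (upper , least) =
      ⊑-antisym (∐-least α δ _ upper) (least _ (∐-upper α δ))

    principalOpen : (c : Carrier) → isFinite D c → ScottOpen D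
    principalOpen c c-fin = record
      { _∈S          = c ⊑_
      ; ∈S-isProp    = ⊑-isProp c
      ; upwardClosed = ⊑-trans
      ; inaccessible = c-fin _
      }

    principalOpen-isCompact : (c : Carrier) (c-fin : isFinite D c)
                            → isCompactOpen D (principalOpen c c-fin)
    principalOpen-isCompact c c-fin _ U _ ↑c⊆⋃U =
      ∥∥-map (λ (i , c∈Uᵢ) → i , λ _ → upwardClosed (U i) c∈Uᵢ) (↑c⊆⋃U c (⊑-refl c))

    module FinitelyGenerated {A : Set 𝓤} (e : A → Carrier)
                             (e-fin : (a : A) → isFinite D (e a)) where

      Any-⊑-∐ : {I : Set 𝓤} (α : I → Carrier) (δ : isDirected D α) {as : List A}
              → Any (λ a → e a ⊑ ∐ α δ) as → ∥ Σ[ i ∈ I ] Any (λ a → e a ⊑ α i) as ∥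
      Any-⊑-∐ α δ (here {x = a} ea⊑∐) = ∥∥-map (λ (i , ea⊑αᵢ) → i , here ea⊑αᵢ) (e-fin a _ α δ ea⊑∐)
      Any-⊑-∐ α δ (there p)           = ∥∥-map (λ (i , q) → i , there q) (Any-⊑-∐ α δ p)

      ⟨_⟩ : List A → ScottOpen D
      ⟨ as ⟩ = record
        { _∈S          = λ y → ∥ Any (λ a → e a ⊑ y) as ∥
        ; ∈S-isProp    = λ _ → ∥∥-isProp
        ; upwardClosed = λ y∈ y⊑z → ∥∥-map (Any.map (λ ea⊑y → ⊑-trans ea⊑y y⊑z)) y∈
        ; inaccessible = λ α δ →
            ∥∥-rec ∥∥-isProp (∥∥-map (λ (i , p) → i , ∣ p ∣) ∘ Any-⊑-∐ α δ)
        }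

      ⟨⟩-isDirected : isDirectedFor _⊆_ ⟨_⟩
      ⟨⟩-isDirected =
          ∣ [] ∣
        , λ as bs → ∣ as ++ bs , (λ _ → ∥∥-map ++⁺ˡ) , (λ _ → ∥∥-map (++⁺ʳ as)) ∣

    module _ (alg : isAlgebraic D) where

      Basis : Set 𝓤
      Basis = proj₁ (proj₂ alg)

      private
        module Basis≃ = Inverse (proj₂ (proj₂ alg))

      basis : Basis → Carrier
      basis = proj₁ ∘ Basis≃.to

      basis-isFinite : (b : Basis) → isFinite D (basis b)
      basis-isFinite = proj₂ ∘ Basis≃.to

      basis-from : (c : Σ Carrier (isFinite D)) → basis (Basis≃.from c) ≡ proj₁ c
      basis-from c = cong proj₁ (Basis≃.strictlyInverseˡ c)

      -- finitesBelow y lives in 𝓤⁺, but Scott opens only see joins of 𝓤-indexed families.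
      basisBelow : Carrier → Set 𝓤
      basisBelow y = Σ[ b ∈ Basis ] (basis b ⊑ y)

      basisBelow-fam : (y : Carrier) → basisBelow y → Carrier
      basisBelow-fam _ = basis ∘ proj₁

      module _ (y : Carrier) where
        private
          finites≲basis : (c : finitesBelow D y)
                        → Σ[ b ∈ basisBelow y ] (proj₁ c ⊑ basisBelow-fam y b)
          finites≲basis (c , c-fin , c⊑y) =
              (Basis≃.from (c , c-fin) , subst (_⊑ y) (sym (basis-from _)) c⊑y)
            , subst (c ⊑_) (sym (basis-from _)) (⊑-refl c)

          basis≲finites : (b : basisBelow y)
                        → Σ[ c ∈ finitesBelow D y ] (basisBelow-fam y b ⊑ proj₁ c)
          basis≲finites (b , b⊑y) = (basis b , basis-isFinite b , b⊑y) , ⊑-refl (basis b)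

        basisBelow-isDirected : isDirected D (basisBelow-fam y)
        basisBelow-isDirected =
          isDirected-cofinal finites≲basis basis≲finites (proj₁ (proj₁ alg y))

        ∐-basisBelow : ∐ (basisBelow-fam y) basisBelow-isDirected ≡ y
        ∐-basisBelow = ∐-unique basisBelow-isDirected
          (isSup-cofinal finites≲basis basis≲finites (proj₂ (proj₁ alg y)))

      module _ (K : ScottOpen D) where

        basisIn : Set 𝓤
        basisIn = Σ[ b ∈ Basis ] (basis b ∈ K)

        open FinitelyGenerated {A = basisIn} (basis ∘ proj₁) (basis-isFinite ∘ proj₁)

        ⟨⟩-⊆ : (bs : List basisIn) → ⟨ bs ⟩ ⊆ K
        ⟨⟩-⊆ bs y = ∥∥-rec (∈S-isProp K y) λ p →
          let ((_ , b∈K) , b⊑y) = satisfied p in upwardClosed K b∈K b⊑y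

        ⊆-⋃⟨⟩ : (y : Carrier) → y ∈ K → y ∈⋃ ⟨_⟩
        ⊆-⋃⟨⟩ y y∈K =
          ∥∥-map (λ ((b , b⊑y) , b∈K) → [ b , b∈K ] , ∣ here b⊑y ∣)
            (inaccessible K _ (basisBelow-isDirected y)
              (subst (_∈ K) (sym (∐-basisBelow y)) y∈K))

        compactOpen-finitelyGenerated
          : isCompactOpen D K
          → ∥ Σ[ bs ∈ List basisIn ] ((y : Carrier) → y ∈ ⟨ bs ⟩ ⇔ y ∈ K) ∥
        compactOpen-finitelyGenerated K-compact =
          ∥∥-map (λ (bs , K⊆⟨bs⟩) → bs , λ y → mk⇔ (⟨⟩-⊆ bs y) (K⊆⟨bs⟩ y))
            (K-compact _ ⟨_⟩ ⟨⟩-isDirected ⊆-⋃⟨⟩)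

        isSharp⇒∈compactOpen-isDecidable
          : {x : Carrier} → isSharp D x → isCompactOpen D K → IsDecidable (x ∈ K)
        isSharp⇒∈compactOpen-isDecidable {x} x-sharp K-compact =
          ∥∥-rec ∥∥-isProp
            (λ (bs , ⟨bs⟩⇔K) → ⇔-isDecidable (⟨bs⟩⇔K x) (∥∥-isDecidable (basis⊑x? bs)))
            (compactOpen-finitelyGenerated K-compact)
          where
          basis⊑x? : (bs : List basisIn) → IsDecidable (Any (λ b → basis (proj₁ b) ⊑ x) bs)
          basis⊑x? = Any-isDecidable (λ (b , _) → x-sharp (basis b) (basis-isFinite b))

mainTheorem15 : (pt : PropTrunc) → FunExt → PropExt → {𝓤 : Level}
    → (D : WithPT.DCPO pt 𝓤) → WithPT.isAlgebraic pt D
    → (x : WithPT.DCPO.Carrier D)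
    → WithPT.isSharp pt D x
      ⇔ ((K : WithPT.ScottOpen pt D) → WithPT.isCompactOpen pt D K
         → WithPT.IsDecidable pt (WithPT._∈_ pt D x K))
mainTheorem15 pt _ _ D alg x = mk⇔
  (λ x-sharp K → isSharp⇒∈compactOpen-isDecidable pt D alg K x-sharp)
  (λ decides c c-fin →
     decides (principalOpen pt D c c-fin) (principalOpen-isCompact pt D c c-fin))
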